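{- Let $H$ be a connected graph with $n_H\ge 2$ vertices and let $G$ be the GP$4$-graph constructed from $H$. Then for every integer $k\le n_H$, $H$ has a paired dominating set of cardinality at most $k$ if and only if $G$ has a paired dominating set of cardinality at most $2n_H+k$.
   Context: All graphs are finite and simple. Given a connected graph $H=(V_H,E_H)$ with $V_H=\{v_1,\dots,v_{n_H}\}$, the GP$4$-graph constructed from $H$ is $G=(V,E)$ with $V=V_H\cup\{w_i,x_i,y_i,z_i : i\in[n_H]\}$ (new distinct vertices) and $E=E_H\cup\{v_iw_i,\,w_ix_i,\,x_iy_i,\,y_iz_i : i\in[n_H]\}$. For a graph with no isolated vertices, a paired dominating set is a set $D$ of vertices such that every vertex outside $D$ has a neighbor in $D$ and the subgraph induced by $D$ has a perfect matching. -}

module Defs where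

open import Data.Nat using (ℕ)
open import Data.Fin using (Fin)
open import Data.List using (List; length)
open import Data.List.Relation.Unary.Unique.Propositional using (Unique)
open import Data.List.Membership.Propositional using (_∈_)
open import Data.Product using (Σ; ∃; _×_; _,_)
open import Data.Sum using (_⊎_)
open import Relation.Nullary using (¬_)
open import Relation.Binary.PropositionalEquality using (_≡_)
open import Relation.Binary.Construct.Closure.ReflexiveTransitive using (Star)

record Graph (V : Set) : Set₁ where
  field
    Adj     : V → V → Set
    sym     : ∀ {u v} → Adj u v → Adj v u
    irrefl  : ∀ v → ¬ Adj v v
open Graph public

Connected : {V : Set} → Graph V → Set
Connected {V} G = ∀ (u v : V) → Star (Adj G) u v

-- D (a duplicate-free list, so |D| = length D) is a paired dominating set:
-- every vertex is in D or adjacent to a vertex of D, and G[D] has a perfect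
-- matching, given as a fixed-point-free involution M on D along edges.
IsPairedDom : {V : Set} → Graph V → List V → Set
IsPairedDom {V} G D =
  Unique D
  × (∀ (u : V) → u ∈ D ⊎ Σ V (λ d → d ∈ D × Adj G u d))
  × Σ (V → V) (λ M → ∀ (d : V) → d ∈ D →
        (M d ∈ D) × Adj G d (M d) × (M (M d) ≡ d))

data GV (n : ℕ) : Set where
  v w x y z : Fin n → GV n

module _ {n : ℕ} (H : Graph (Fin n)) where
  data GAdj : GV n → GV n → Set where
    vv : ∀ {i j} → Adj H i j → GAdj (v i) (v j)
    vw : ∀ {i} → GAdj (v i) (w i)
    wv : ∀ {i} → GAdj (w i) (v i)
    wx : ∀ {i} → GAdj (w i) (x i)
    xw : ∀ {i} → GAdj (x i) (w i)
    xy : ∀ {i} → GAdj (x i) (y i)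
    yx : ∀ {i} → GAdj (y i) (x i)
    yz : ∀ {i} → GAdj (y i) (z i)
    zy : ∀ {i} → GAdj (z i) (y i)

  GAdj-sym : ∀ {a b} → GAdj a b → GAdj b a
  GAdj-sym (vv e) = vv (sym H e)
  GAdj-sym vw = wv
  GAdj-sym wv = vw
  GAdj-sym wx = xw
  GAdj-sym xw = wx
  GAdj-sym xy = yx
  GAdj-sym yx = xy
  GAdj-sym yz = zy
  GAdj-sym zy = yz

  GAdj-irrefl : ∀ a → ¬ GAdj a a
  GAdj-irrefl (v i) (vv e) = irrefl H i e

  GP4 : Graph (GV n)
  GP4 = record { Adj = GAdj ; sym = GAdj-sym ; irrefl = GAdj-irrefl }

module Submission where

-- Lifting: if D is a paired dominating set of H, then v(D) plus all x i, y i
-- (x i paired with y i) is one of G = GP4 H, of size |D| + 2n.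
-- Projection: for a paired dominating set D' of G, label each i of H as
-- matched (v i ∈ D' is mated to some v j), unmatched (otherwise v i or w i is
-- in D') or out, with weights 1, 2, 0. Every gadget v i w i x i y i z i holds
-- y i and its mate, and a gadget-by-gadget count gives 2n + weight ≤ |D'|.
-- A repair lemma, valid in every graph without isolated vertices, removes the
-- unmatched vertices one at a time without increasing the weight, yielding a
-- paired dominating set of H of size at most the weight. Connectivity and
-- n ≥ 2 rule out isolated vertices.

module PairedDomination where

  open import Data.Nat using (ℕ; zero; suc; _+_; _≤_; z≤n; s≤s) renaming (_*_ to _*ℕ_)
  import Data.Nat as ℕ
  open import Data.Nat.Properties
    using (+-assoc; +-mono-≤; +-monoʳ-≤; +-cancelʳ-≡; *-suc; ≤-reflexive; ≤-refl; ≤-trans; m≤n+m; suc-injective)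
  open import Data.Nat.Tactic.RingSolver using (solve-∀)
  open import Data.Bool using (Bool; true; false)
  open import Data.Fin using (Fin; zero; suc)
  open import Data.Fin.Properties using (_≟_; any?)
  open import Data.Vec.Functional using (updateAt)
  open import Data.Vec.Functional.Properties using (updateAt-updates; updateAt-minimal)
  open import Data.List using (List; []; _∷_; _++_; length; filter; tabulate; allFin; map)
  open import Data.List.Properties using (length-++; length-map; length-tabulate)
  open import Data.List.Relation.Unary.All as All using (All; []; _∷_)
  open import Data.List.Relation.Unary.Any using (here; there)
  open import Data.List.Relation.Unary.Unique.Propositional using (Unique; []; _∷_)
  open import Data.List.Relation.Unary.Unique.Propositional.Properties
    using (filter⁺; allFin⁺; map⁺; ++⁺; tabulate⁺)
  open import Data.List.Membership.Propositional using (_∈_; _∉_)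
  open import Data.List.Membership.Propositional.Properties
    using (∈-∃++; ∈-++⁺ˡ; ∈-++⁺ʳ; ∈-++⁻; ∈-filter⁺; ∈-filter⁻; ∈-allFin; ∈-map⁺; ∈-map⁻; ∈-tabulate⁺; ∈-tabulate⁻)
  open import Data.Sum using (_⊎_; inj₁; inj₂)
  open import Data.Product using (Σ; _×_; _,_; proj₁; proj₂)
  open import Data.Product.Properties using (≡-dec)
  open import Data.Empty using (⊥-elim)
  open import Function using (_∘_; const; id)
  open import Relation.Nullary using (¬_; Dec; does; yes; no; _×-dec_; contradiction)
  open import Relation.Nullary.Decidable using (map′)
  open import Relation.Binary.Definitions using (DecidableEquality)
  open import Relation.Binary.Construct.Closure.ReflexiveTransitive using (Star; ε; _◅_)
  open import Relation.Binary.PropositionalEquality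
  open ≡-Reasoning
  open import Defs using (Graph; Adj; Connected; IsPairedDom; GV; v; w; x; y; z; GAdj; GP4)
  open GAdj

  ∑ : ∀ {n} → (Fin n → ℕ) → ℕ
  ∑ {zero}  f = 0
  ∑ {suc n} f = f zero + ∑ (f ∘ suc)

  ∑-mono-≤ : ∀ {n} {f g : Fin n → ℕ} → (∀ i → f i ≤ g i) → ∑ f ≤ ∑ g
  ∑-mono-≤ {zero}  f≤g = z≤n
  ∑-mono-≤ {suc n} f≤g = +-mono-≤ (f≤g zero) (∑-mono-≤ (f≤g ∘ suc))

  ∑-distrib-+ : ∀ {n} (f g : Fin n → ℕ) → ∑ (λ i → f i + g i) ≡ ∑ f + ∑ g
  ∑-distrib-+ {zero}  f g = refl
  ∑-distrib-+ {suc n} f g = begin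
    f zero + g zero + ∑ (λ i → f (suc i) + g (suc i)) ≡⟨ cong (f zero + g zero +_) (∑-distrib-+ (f ∘ suc) (g ∘ suc)) ⟩
    f zero + g zero + (∑ (f ∘ suc) + ∑ (g ∘ suc))     ≡⟨ shuffle (f zero) (g zero) (∑ (f ∘ suc)) (∑ (g ∘ suc)) ⟩
    f zero + ∑ (f ∘ suc) + (g zero + ∑ (g ∘ suc))     ∎
    where
    shuffle : ∀ a b c d → a + b + (c + d) ≡ a + c + (b + d)
    shuffle = solve-∀

  ∑-cong : ∀ {n} {f g : Fin n → ℕ} → (∀ i → f i ≡ g i) → ∑ f ≡ ∑ g
  ∑-cong {zero}  f≗g = refl
  ∑-cong {suc n} f≗g = cong₂ _+_ (f≗g zero) (∑-cong (f≗g ∘ suc))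

  ∑-zero : ∀ {n} → ∑ {n} (const 0) ≡ 0
  ∑-zero {zero}  = refl
  ∑-zero {suc n} = ∑-zero {n}

  ∑-2+ : ∀ {n} (f : Fin n → ℕ) → ∑ (λ i → 2 + f i) ≡ 2 *ℕ n + ∑ f
  ∑-2+ {zero}  f = refl
  ∑-2+ {suc n} f = begin
    2 + f zero + ∑ (λ i → 2 + f (suc i)) ≡⟨ cong (2 + f zero +_) (∑-2+ (f ∘ suc)) ⟩
    2 + f zero + (2 *ℕ n + ∑ (f ∘ suc)) ≡⟨ shuffle (f zero) (2 *ℕ n) (∑ (f ∘ suc)) ⟩
    2 + 2 *ℕ n + (f zero + ∑ (f ∘ suc)) ≡⟨ cong (_+ (f zero + ∑ (f ∘ suc))) (sym (*-suc 2 n)) ⟩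
    2 *ℕ suc n + (f zero + ∑ (f ∘ suc)) ∎
    where
    shuffle : ∀ a b c → 2 + a + (b + c) ≡ 2 + b + (a + c)
    shuffle = solve-∀

  bit : Bool → ℕ
  bit true  = 1
  bit false = 0

  ∑-indicator : ∀ {n} (j : Fin n) → ∑ (λ i → bit (does (j ≟ i))) ≡ 1
  ∑-indicator {suc n} zero    = cong suc (∑-zero {n})
  ∑-indicator {suc n} (suc j) = ∑-indicator j

  _[_]≔_ : ∀ {n} {A : Set} → (Fin n → A) → Fin n → A → Fin n → A
  f [ u ]≔ a = updateAt f u (const a)

  ≔-same : ∀ {n} {A : Set} (f : Fin n → A) u {a} → (f [ u ]≔ a) u ≡ a
  ≔-same f u = updateAt-updates u f

  ≔-other : ∀ {n} {A : Set} (f : Fin n → A) {u a} i → i ≢ u → (f [ u ]≔ a) i ≡ f i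
  ≔-other f i i≢u = updateAt-minimal i _ f i≢u

  ∑-update : ∀ {n} {A : Set} (g : A → ℕ) (f : Fin n → A) u a →
    ∑ (g ∘ (f [ u ]≔ a)) + g (f u) ≡ ∑ (g ∘ f) + g a
  ∑-update {suc n} g f zero    a = swap (g a) (∑ (g ∘ f ∘ suc)) (g (f zero))
    where
    swap : ∀ p q r → p + q + r ≡ r + q + p
    swap = solve-∀
  ∑-update {suc n} g f (suc u) a = begin
    g₀ + ∑ (g ∘ ((f ∘ suc) [ u ]≔ a)) + g (f (suc u))   ≡⟨ +-assoc g₀ _ _ ⟩
    g₀ + (∑ (g ∘ ((f ∘ suc) [ u ]≔ a)) + g (f (suc u))) ≡⟨ cong (g₀ +_) (∑-update g (f ∘ suc) u a) ⟩
    g₀ + (∑ (g ∘ f ∘ suc) + g a)                        ≡⟨ sym (+-assoc g₀ _ _) ⟩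
    g₀ + ∑ (g ∘ f ∘ suc) + g a                          ∎
    where g₀ = g (f zero)

  ∑-update-down : ∀ {n} {A : Set} (g : A → ℕ) (f : Fin n → A) {u a} d →
    g (f u) ≡ d + g a → d + ∑ (g ∘ (f [ u ]≔ a)) ≡ ∑ (g ∘ f)
  ∑-update-down g f {u} {a} d drop = +-cancelʳ-≡ (g a) _ _ (begin
    d + ∑ (g ∘ (f [ u ]≔ a)) + g a   ≡⟨ shuffle d (∑ (g ∘ (f [ u ]≔ a))) (g a) ⟩
    ∑ (g ∘ (f [ u ]≔ a)) + (d + g a) ≡⟨ cong (∑ (g ∘ (f [ u ]≔ a)) +_) (sym drop) ⟩
    ∑ (g ∘ (f [ u ]≔ a)) + g (f u)   ≡⟨ ∑-update g f u a ⟩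
    ∑ (g ∘ f) + g a                  ∎)
    where
    shuffle : ∀ p q r → p + q + r ≡ q + (p + r)
    shuffle = solve-∀

  ∑-update-up : ∀ {n} {A : Set} (g : A → ℕ) (f : Fin n → A) {u a} d →
    g a ≡ d + g (f u) → ∑ (g ∘ (f [ u ]≔ a)) ≡ d + ∑ (g ∘ f)
  ∑-update-up g f {u} {a} d rise = +-cancelʳ-≡ (g (f u)) _ _ (begin
    ∑ (g ∘ (f [ u ]≔ a)) + g (f u)   ≡⟨ ∑-update g f u a ⟩
    ∑ (g ∘ f) + g a                  ≡⟨ cong (∑ (g ∘ f) +_) rise ⟩
    ∑ (g ∘ f) + (d + g (f u))        ≡⟨ shuffle (∑ (g ∘ f)) d (g (f u)) ⟩
    d + ∑ (g ∘ f) + g (f u)          ∎)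
    where
    shuffle : ∀ p q r → p + (q + r) ≡ q + p + r
    shuffle = solve-∀

  length-++-∷ : ∀ {A : Set} (ys₁ : List A) {a ys₂} → length (ys₁ ++ a ∷ ys₂) ≡ suc (length (ys₁ ++ ys₂))
  length-++-∷ []        = refl
  length-++-∷ (_ ∷ ys₁) = cong suc (length-++-∷ ys₁)

  ∈-delete : ∀ {A : Set} (ys₁ : List A) {a b ys₂} → a ≢ b → b ∈ ys₁ ++ a ∷ ys₂ → b ∈ ys₁ ++ ys₂
  ∈-delete ys₁ a≢b b∈ with ∈-++⁻ ys₁ b∈
  ... | inj₁ b∈ys₁         = ∈-++⁺ˡ b∈ys₁
  ... | inj₂ (here refl)   = ⊥-elim (a≢b refl)
  ... | inj₂ (there b∈ys₂) = ∈-++⁺ʳ ys₁ b∈ys₂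

  unique-⊆-length : ∀ {A : Set} {xs ys : List A} → Unique xs → (∀ {a} → a ∈ xs → a ∈ ys) →
    length xs ≤ length ys
  unique-⊆-length {xs = []}     _            _     = z≤n
  unique-⊆-length {xs = a ∷ xs} (a∉xs ∷ uxs) xs⊆ys with ∈-∃++ (xs⊆ys (here refl))
  ... | ys₁ , ys₂ , refl =
    ≤-trans (s≤s (unique-⊆-length uxs xs⊆rest)) (≤-reflexive (sym (length-++-∷ ys₁)))
    where
    xs⊆rest : ∀ {b} → b ∈ xs → b ∈ ys₁ ++ ys₂
    xs⊆rest b∈xs = ∈-delete ys₁ (All.lookup a∉xs b∈xs) (xs⊆ys (there b∈xs))

  fibre : ∀ {A : Set} {n} → (A → Fin n) → Fin n → List A → List A
  fibre key i = filter (λ a → key a ≟ i)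

  length-fibre-∷ : ∀ {A : Set} {n} (key : A → Fin n) i a L →
    length (fibre key i (a ∷ L)) ≡ bit (does (key a ≟ i)) + length (fibre key i L)
  length-fibre-∷ key i a L with does (key a ≟ i)
  ... | true  = refl
  ... | false = refl

  ∑-length-fibre : ∀ {A : Set} {n} (key : A → Fin n) L → ∑ (λ i → length (fibre key i L)) ≡ length L
  ∑-length-fibre {n = n} key []      = ∑-zero {n}
  ∑-length-fibre {n = n} key (a ∷ L) = begin
    ∑ (λ i → length (fibre key i (a ∷ L)))                       ≡⟨ ∑-cong (λ i → length-fibre-∷ key i a L) ⟩
    ∑ (λ i → bit (does (key a ≟ i)) + length (fibre key i L))    ≡⟨ ∑-distrib-+ {n} _ _ ⟩
    ∑ (λ i → bit (does (key a ≟ i))) + ∑ (λ i → length (fibre key i L))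
                                                                 ≡⟨ cong₂ _+_ (∑-indicator (key a)) (∑-length-fibre key L) ⟩
    suc (length L)                                               ∎

  length-filter-tabulate : ∀ {A : Set} {P : A → Set} (P? : ∀ a → Dec (P a)) {m} (h : Fin m → A) →
    length (filter P? (tabulate h)) ≡ ∑ (λ i → bit (does (P? (h i))))
  length-filter-tabulate P? {zero}  h = refl
  length-filter-tabulate P? {suc m} h with does (P? (h zero))
  ... | true  = cong suc (length-filter-tabulate P? (h ∘ suc))
  ... | false = length-filter-tabulate P? (h ∘ suc)

  data Status : Set where
    out matched unmatched : Status

  _≟ₛ_ : DecidableEquality Status
  out       ≟ₛ out       = yes refl
  matched   ≟ₛ matched   = yes refl
  unmatched ≟ₛ unmatched = yes refl
  out       ≟ₛ matched   = no λ ()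
  out       ≟ₛ unmatched = no λ ()
  matched   ≟ₛ out       = no λ ()
  matched   ≟ₛ unmatched = no λ ()
  unmatched ≟ₛ out       = no λ ()
  unmatched ≟ₛ matched   = no λ ()

  -- How many vertices of the final paired dominating set a status pays for:
  -- an unmatched vertex pays for itself and its future partner.
  weight : Status → ℕ
  weight out       = 0
  weight matched   = 1
  weight unmatched = 2

  pending : Status → ℕ
  pending unmatched = 1
  pending _         = 0

  module Repair {n : ℕ} (H : Graph (Fin n)) where

    -- A paired dominating structure with defects: matched vertices come in
    -- adjacent matched pairs, out vertices have a non-out neighbour, and
    -- unmatched vertices are the defects (in the set but without a partner).
    record Labelling : Set where
      field
        status       : Fin n → Status
        partner      : Fin n → Fin n
        dominator    : Fin n → Fin n
        partner-ok   : ∀ i → status i ≡ matched →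
                       status (partner i) ≡ matched × Adj H i (partner i) × partner (partner i) ≡ i
        dominator-ok : ∀ i → status i ≡ out → status (dominator i) ≢ out × Adj H i (dominator i)
    open Labelling

    weightOf : Labelling → ℕ
    weightOf s = ∑ (weight ∘ status s)

    pendingOf : Labelling → ℕ
    pendingOf s = ∑ (pending ∘ status s)

    Improvement : Labelling → Labelling → Set
    Improvement s s' = weightOf s' ≤ weightOf s × suc (pendingOf s') ≡ pendingOf s

    -- Repair an unmatched u by matching it with an out neighbour t: the weight
    -- is unchanged (2 + 0 = 1 + 1).
    module MatchWith (s : Labelling) {u t} (u-unm : status s u ≡ unmatched) (t-out : status s t ≡ out)
                     (u~t : Adj H u t) where
      u≢t : u ≢ t
      u≢t refl with trans (sym u-unm) t-out
      ... | ()

      status₁ status' : Fin n → Status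
      status₁ = status s [ u ]≔ matched
      status' = status₁ [ t ]≔ matched

      partner' : Fin n → Fin n
      partner' = (partner s [ u ]≔ t) [ t ]≔ u

      status₁-t : status₁ t ≡ out
      status₁-t = trans (≔-other (status s) t (u≢t ∘ sym)) t-out

      status'-u : status' u ≡ matched
      status'-u = trans (≔-other status₁ u u≢t) (≔-same (status s) u)

      partner'-t : partner' t ≡ u
      partner'-t = ≔-same _ t

      partner'-u : partner' u ≡ t
      partner'-u = trans (≔-other _ u u≢t) (≔-same (partner s) u)

      status'-else : ∀ j → j ≢ u → j ≢ t → status' j ≡ status s j
      status'-else j j≢u j≢t = trans (≔-other status₁ j j≢t) (≔-other (status s) j j≢u)

      partner'-else : ∀ j → j ≢ u → j ≢ t → partner' j ≡ partner s j
      partner'-else j j≢u j≢t = trans (≔-other _ j j≢t) (≔-other (partner s) j j≢u)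

      -- Statuses only change to matched, so out vertices were out before.
      status'-out : ∀ j → status' j ≡ out → status s j ≡ out
      status'-out j j-out with j ≟ u | j ≟ t
      ... | yes refl | _ with trans (sym status'-u) j-out
      ...   | ()
      status'-out j j-out | no _ | yes refl with trans (sym (≔-same status₁ t)) j-out
      ...   | ()
      status'-out j j-out | no j≢u | no j≢t = trans (sym (status'-else j j≢u j≢t)) j-out

      -- The old partner p of a matched vertex is neither u (unmatched) nor t (out).
      partner-ok' : ∀ i → status' i ≡ matched →
        status' (partner' i) ≡ matched × Adj H i (partner' i) × partner' (partner' i) ≡ i
      partner-ok' i i-mat with i ≟ u | i ≟ t
      ... | yes refl | _ rewrite partner'-u = ≔-same status₁ t , u~t , partner'-t
      ... | no _ | yes refl rewrite partner'-t = status'-u , Graph.sym H u~t , partner'-u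
      ... | no i≢u | no i≢t with partner-ok s i (trans (sym (status'-else i i≢u i≢t)) i-mat)
      ...   | p-mat , i~p , pp≡i rewrite partner'-else i i≢u i≢t =
        trans (status'-else p p≢u p≢t) p-mat , i~p , trans (partner'-else p p≢u p≢t) pp≡i
        where
        p = partner s i
        p≢u : p ≢ u
        p≢u p≡u with trans (sym p-mat) (trans (cong (status s) p≡u) u-unm)
        ... | ()
        p≢t : p ≢ t
        p≢t p≡t with trans (sym p-mat) (trans (cong (status s) p≡t) t-out)
        ... | ()

      dominator-ok' : ∀ i → status' i ≡ out → status' (dominator s i) ≢ out × Adj H i (dominator s i)
      dominator-ok' i i-out with dominator-ok s i (status'-out i i-out)
      ... | d-in , i~d = d-in ∘ status'-out (dominator s i) , i~d

      result : Labelling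
      result = record { status = status' ; partner = partner' ; dominator = dominator s
                      ; partner-ok = partner-ok' ; dominator-ok = dominator-ok' }

      repaired : Σ Labelling (Improvement s)
      repaired = result , ≤-reflexive weight-same , pending-drop
        where
        weight-same : weightOf result ≡ weightOf s
        weight-same = trans (∑-update-up weight status₁ 1 (cong (λ σ → 1 + weight σ) (sym status₁-t)))
                            (∑-update-down weight (status s) 1 (cong weight u-unm))
        pending-drop : suc (pendingOf result) ≡ pendingOf s
        pending-drop = trans (cong suc (∑-update-up pending status₁ 0 (cong pending (sym status₁-t))))
                             (∑-update-down pending (status s) 1 (cong pending u-unm))

    -- Repair an unmatched u that dominates no out vertex by making it out,
    -- dominated by a non-out neighbour p: the weight drops by 2.
    module DropTo (s : Labelling) {u p} (u-unm : status s u ≡ unmatched) (u~p : Adj H u p)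
                  (p-in : status s p ≢ out) (u-idle : ∀ t → status s t ≡ out → dominator s t ≢ u) where
      status' : Fin n → Status
      status' = status s [ u ]≔ out

      dominator' : Fin n → Fin n
      dominator' = dominator s [ u ]≔ p

      status'-else : ∀ j → j ≢ u → status' j ≡ status s j
      status'-else = ≔-other (status s)

      p≢u : p ≢ u
      p≢u refl = Graph.irrefl H p u~p

      partner-ok' : ∀ i → status' i ≡ matched →
        status' (partner s i) ≡ matched × Adj H i (partner s i) × partner s (partner s i) ≡ i
      partner-ok' i i-mat with i ≟ u
      ... | yes refl with trans (sym (≔-same (status s) i)) i-mat
      ...   | ()
      partner-ok' i i-mat | no i≢u with partner-ok s i (trans (sym (status'-else i i≢u)) i-mat)
      ...   | q-mat , i~q , qq≡i = trans (status'-else q q≢u) q-mat , i~q , qq≡i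
        where
        q = partner s i
        q≢u : q ≢ u
        q≢u q≡u with trans (sym q-mat) (trans (cong (status s) q≡u) u-unm)
        ... | ()

      -- Old out vertices keep their dominators, which are not u.
      dominator-ok' : ∀ i → status' i ≡ out → status' (dominator' i) ≢ out × Adj H i (dominator' i)
      dominator-ok' i i-out with i ≟ u
      ... | yes refl rewrite ≔-same (dominator s) i {p} | status'-else p p≢u = p-in , u~p
      ... | no i≢u with status s i ≟ₛ out
      ...   | no i-in = ⊥-elim (i-in (trans (sym (status'-else i i≢u)) i-out))
      ...   | yes i-was-out with dominator-ok s i i-was-out
      ...     | d-in , i~d rewrite ≔-other (dominator s) {a = p} i i≢u
                               | status'-else (dominator s i) (u-idle i i-was-out) = d-in , i~d

      result : Labelling
      result = record { status = status' ; partner = partner s ; dominator = dominator'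
                      ; partner-ok = partner-ok' ; dominator-ok = dominator-ok' }

      repaired : Σ Labelling (Improvement s)
      repaired = result , weight-drop , ∑-update-down pending (status s) 1 (cong pending u-unm)
        where
        weight-drop : weightOf result ≤ weightOf s
        weight-drop = ≤-trans (m≤n+m (weightOf result) 2)
                              (≤-reflexive (∑-update-down weight (status s) 2 (cong weight u-unm)))

    -- In a graph without isolated vertices every defect can be repaired: with
    -- p a neighbour of u, match u with p if p is out, else with an out vertex
    -- that u dominates, and if there is none, drop u.
    repairOne : (∀ u → Σ (Fin n) (Adj H u)) → (s : Labelling) → ∀ u → status s u ≡ unmatched →
      Σ Labelling (Improvement s)
    repairOne neighbour s u u-unm with neighbour u
    ... | p , u~p with status s p ≟ₛ out
    ...   | yes p-out = MatchWith.repaired s u-unm p-out u~p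
    ...   | no p-in with any? (λ t → status s t ≟ₛ out ×-dec dominator s t ≟ u)
    ...     | yes (t , t-out , refl) =
                MatchWith.repaired s u-unm t-out (Graph.sym H (proj₂ (dominator-ok s t t-out)))
    ...     | no u-idle = DropTo.repaired s u-unm u~p p-in λ t t-out t→u → u-idle (t , t-out , t→u)

    Settled : Labelling → Set
    Settled s = ∀ i → status s i ≢ unmatched

    repairAll : (∀ u → Σ (Fin n) (Adj H u)) → ∀ k (s : Labelling) → pendingOf s ≡ k →
      Σ Labelling (λ s' → weightOf s' ≤ weightOf s × Settled s')
    repairAll neighbour k s pending≡k with any? (λ i → status s i ≟ₛ unmatched)
    ... | no settled = s , ≤-refl , λ i i-unm → settled (i , i-unm)
    ... | yes (u , u-unm) with repairOne neighbour s u u-unm | k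
    ...   | s₁ , _ , drop | zero with trans drop pending≡k
    ...     | ()
    repairAll neighbour k s pending≡k | yes _ | s₁ , lighter , drop | suc k₁
      with repairAll neighbour k₁ s₁ (suc-injective (trans drop pending≡k))
    ...   | s₂ , lighter₂ , settled = s₂ , ≤-trans lighter₂ lighter , settled

    settled⇒paired : (s : Labelling) → Settled s → Σ (List (Fin n)) (λ D → IsPairedDom H D × length D ≤ weightOf s)
    settled⇒paired s settled = D , (filter⁺ matched? (allFin⁺ n) , dominated , partner s , paired) , size
      where
      matched? = λ i → status s i ≟ₛ matched
      D = filter matched? (allFin n)
      ∈D : ∀ {i} → status s i ≡ matched → i ∈ D
      ∈D i-mat = ∈-filter⁺ matched? (∈-allFin _) i-mat
      non-out⇒matched : ∀ i → status s i ≢ out → status s i ≡ matched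
      non-out⇒matched i i-in with status s i | settled i
      ... | out       | _     = ⊥-elim (i-in refl)
      ... | matched   | _     = refl
      ... | unmatched | i-set = ⊥-elim (i-set refl)
      dominated : ∀ u → u ∈ D ⊎ Σ (Fin n) (λ d → d ∈ D × Adj H u d)
      dominated u with status s u ≟ₛ out
      ... | no u-in = inj₁ (∈D (non-out⇒matched u u-in))
      ... | yes u-out with dominator-ok s u u-out
      ...   | d-in , u~d = inj₂ (dominator s u , ∈D (non-out⇒matched _ d-in) , u~d)
      paired : ∀ d → d ∈ D → (partner s d ∈ D) × Adj H d (partner s d) × partner s (partner s d) ≡ d
      paired d d∈D with partner-ok s d (proj₂ (∈-filter⁻ matched? {xs = allFin n} d∈D))
      ... | p-mat , d~p , pp≡d = ∈D p-mat , d~p , pp≡d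
      bit≤weight : ∀ σ → bit (does (σ ≟ₛ matched)) ≤ weight σ
      bit≤weight out       = z≤n
      bit≤weight matched   = s≤s z≤n
      bit≤weight unmatched = z≤n
      size : length D ≤ weightOf s
      size = ≤-trans (≤-reflexive (length-filter-tabulate matched? id)) (∑-mono-≤ (bit≤weight ∘ status s))

    pairedDominatingOfLabelling : (∀ u → Σ (Fin n) (Adj H u)) → (s : Labelling) →
      Σ (List (Fin n)) (λ D → IsPairedDom H D × length D ≤ weightOf s)
    pairedDominatingOfLabelling neighbour s with repairAll neighbour (pendingOf s) s refl
    ... | s' , lighter , settled with settled⇒paired s' settled
    ...   | D , D-pd , small = D , D-pd , ≤-trans small lighter

  walk-first-edge : ∀ {V : Set} (H : Graph V) {a b} → Star (Adj H) a b → a ≢ b → Σ V (Adj H a)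
  walk-first-edge H ε       a≢a = ⊥-elim (a≢a refl)
  walk-first-edge H (e ◅ _) _   = _ , e

  connected⇒neighbour : ∀ {m} (H : Graph (Fin (suc (suc m)))) → Connected H →
    ∀ u → Σ (Fin (suc (suc m))) (Adj H u)
  connected⇒neighbour H conn zero    = walk-first-edge H (conn zero (suc zero)) λ ()
  connected⇒neighbour H conn (suc u) = walk-first-edge H (conn (suc u) zero) λ ()

  gadget : ∀ {n} → GV n → Fin n
  gadget (v i) = i
  gadget (w i) = i
  gadget (x i) = i
  gadget (y i) = i
  gadget (z i) = i

  module _ {n : ℕ} where
    private
      encode : GV n → ℕ × Fin n
      encode (v i) = 0 , i
      encode (w i) = 1 , i
      encode (x i) = 2 , i
      encode (y i) = 3 , i
      encode (z i) = 4 , i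

      decode : ℕ × Fin n → GV n
      decode (0 , i) = v i
      decode (1 , i) = w i
      decode (2 , i) = x i
      decode (3 , i) = y i
      decode (_ , i) = z i

      decode-encode : ∀ a → decode (encode a) ≡ a
      decode-encode (v i) = refl
      decode-encode (w i) = refl
      decode-encode (x i) = refl
      decode-encode (y i) = refl
      decode-encode (z i) = refl

      encode-injective : ∀ {a b} → encode a ≡ encode b → a ≡ b
      encode-injective {a} {b} e = trans (sym (decode-encode a)) (trans (cong decode e) (decode-encode b))

    _≟ᵥ_ : DecidableEquality (GV n)
    a ≟ᵥ b = map′ encode-injective (cong encode) (≡-dec ℕ._≟_ _≟_ (encode a) (encode b))

  module Lift {n : ℕ} (H : Graph (Fin n)) (D : List (Fin n)) (D-pd : IsPairedDom H D) where
    private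
      D-unique = proj₁ D-pd
      D-dominates = proj₁ (proj₂ D-pd)
      D-partner = proj₁ (proj₂ (proj₂ D-pd))
      D-partner-ok = proj₂ (proj₂ (proj₂ D-pd))

    XY : List (GV n)
    XY = tabulate x ++ tabulate y

    lifted : List (GV n)
    lifted = map v D ++ XY

    v∈ : ∀ {i} → i ∈ D → v i ∈ lifted
    v∈ i∈D = ∈-++⁺ˡ (∈-map⁺ v i∈D)

    x∈ : ∀ i → x i ∈ lifted
    x∈ i = ∈-++⁺ʳ (map v D) (∈-++⁺ˡ (∈-tabulate⁺ i))

    y∈ : ∀ i → y i ∈ lifted
    y∈ i = ∈-++⁺ʳ (map v D) (∈-++⁺ʳ (tabulate x) (∈-tabulate⁺ i))

    XY-shape : ∀ {a} → a ∈ XY → Σ (Fin n) (λ i → a ≡ x i) ⊎ Σ (Fin n) (λ i → a ≡ y i)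
    XY-shape a∈ with ∈-++⁻ (tabulate x) a∈
    ... | inj₁ a∈X = inj₁ (∈-tabulate⁻ {f = x} a∈X)
    ... | inj₂ a∈Y = inj₂ (∈-tabulate⁻ {f = y} a∈Y)

    unique : Unique lifted
    unique = ++⁺ (map⁺ v-injective D-unique) (++⁺ (tabulate⁺ x-injective) (tabulate⁺ y-injective) X∩Y) V∩XY
      where
      v-injective : ∀ {i j} → v {n} i ≡ v j → i ≡ j
      v-injective refl = refl
      x-injective : ∀ {i j} → x {n} i ≡ x j → i ≡ j
      x-injective refl = refl
      y-injective : ∀ {i j} → y {n} i ≡ y j → i ≡ j
      y-injective refl = refl
      X∩Y : ∀ {a} → ¬ (a ∈ tabulate x × a ∈ tabulate y)
      X∩Y (a∈X , a∈Y) with ∈-tabulate⁻ {f = x} a∈X | ∈-tabulate⁻ {f = y} a∈Y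
      ... | _ , refl | _ , ()
      V∩XY : ∀ {a} → ¬ (a ∈ map v D × a ∈ XY)
      V∩XY (a∈V , a∈XY) with ∈-map⁻ v a∈V | XY-shape a∈XY
      ... | _ , _ , refl | inj₁ (_ , ())
      ... | _ , _ , refl | inj₂ (_ , ())

    dominates : ∀ a → a ∈ lifted ⊎ Σ (GV n) (λ d → d ∈ lifted × GAdj H a d)
    dominates (v i) with D-dominates i
    ... | inj₁ i∈D           = inj₁ (v∈ i∈D)
    ... | inj₂ (d , d∈D , e) = inj₂ (v d , v∈ d∈D , vv e)
    dominates (w i) = inj₂ (x i , x∈ i , wx)
    dominates (x i) = inj₁ (x∈ i)
    dominates (y i) = inj₁ (y∈ i)
    dominates (z i) = inj₂ (y i , y∈ i , zy)

    partner : GV n → GV n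
    partner (v i) = v (D-partner i)
    partner (x i) = y i
    partner (y i) = x i
    partner a     = a

    partner-ok : ∀ a → a ∈ lifted → (partner a ∈ lifted) × GAdj H a (partner a) × partner (partner a) ≡ a
    partner-ok a a∈ with ∈-++⁻ (map v D) a∈
    ... | inj₁ a∈V with ∈-map⁻ v a∈V
    ...   | i , i∈D , refl with D-partner-ok i i∈D
    ...     | p∈D , i~p , pp≡i = v∈ p∈D , vv i~p , cong v pp≡i
    partner-ok a a∈ | inj₂ a∈XY with XY-shape a∈XY
    ... | inj₁ (i , refl) = y∈ i , xy , refl
    ... | inj₂ (i , refl) = x∈ i , yx , refl

    lifted-pd : IsPairedDom (GP4 H) lifted
    lifted-pd = unique , dominates , partner , partner-ok

    length-lifted : length lifted ≡ 2 *ℕ n + length D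
    length-lifted = begin
      length (map v D ++ XY)               ≡⟨ length-++ (map v D) ⟩
      length (map v D) + length XY         ≡⟨ cong₂ _+_ (length-map v D) (length-++ X) ⟩
      length D + (length X + length Y)     ≡⟨ cong (length D +_) (cong₂ _+_ (length-tabulate {n = n} x) (length-tabulate {n = n} y)) ⟩
      length D + (n + n)                   ≡⟨ shuffle (length D) n ⟩
      2 *ℕ n + length D                    ∎
      where
      X Y : List (GV n)
      X = tabulate x
      Y = tabulate y
      shuffle : ∀ d m → d + (m + m) ≡ 2 *ℕ m + d
      shuffle = solve-∀

  module Project {n : ℕ} (H : Graph (Fin n)) (D' : List (GV n)) (D'-pd : IsPairedDom (GP4 H) D') where
    open import Data.List.Membership.DecPropositional (_≟ᵥ_ {n}) using (_∈?_)
    open Repair H using (Labelling; weightOf)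

    private
      dominates = proj₁ (proj₂ D'-pd)
      mate = proj₁ (proj₂ (proj₂ D'-pd))
      mate-ok = proj₂ (proj₂ (proj₂ D'-pd))

    mate-back : ∀ {a b} → a ∈ D' → mate a ≡ b → mate b ≡ a
    mate-back {a} a∈ refl = proj₂ (proj₂ (mate-ok a a∈))

    adj-z : ∀ {i a} → GAdj H (z i) a → a ≡ y i
    adj-z zy = refl

    adj-y : ∀ {i a} → GAdj H (y i) a → a ≡ x i ⊎ a ≡ z i
    adj-y yx = inj₁ refl
    adj-y yz = inj₂ refl

    adj-w : ∀ {i a} → GAdj H (w i) a → a ≡ v i ⊎ a ≡ x i
    adj-w wv = inj₁ refl
    adj-w wx = inj₂ refl

    adj-v : ∀ {i a} → GAdj H (v i) a → Σ (Fin n) (λ j → a ≡ v j × Adj H i j) ⊎ a ≡ w i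
    adj-v (vv i~j) = inj₁ (_ , refl , i~j)
    adj-v vw       = inj₂ refl

    -- Status of vertex i of H from the gadget of i: matched if v i is in D'
    -- with a mate in H, unmatched if v i or w i is in D' otherwise, else out.
    statusOf : ∀ {A B : Set} → Dec A → GV n → Dec B → Status
    statusOf (yes _) (v _) _       = matched
    statusOf (yes _) _     _       = unmatched
    statusOf (no _)  _     (yes _) = unmatched
    statusOf (no _)  _     (no _)  = out

    statusOf-matched : ∀ {A B : Set} (a? : Dec A) m (b? : Dec B) → statusOf a? m b? ≡ matched →
      A × Σ (Fin n) (λ j → m ≡ v j)
    statusOf-matched (yes a) (v j) _ _ = a , j , refl
    statusOf-matched (yes a) (w j) _ ()
    statusOf-matched (yes a) (x j) _ ()
    statusOf-matched (yes a) (y j) _ ()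
    statusOf-matched (yes a) (z j) _ ()
    statusOf-matched (no _)  _ (yes _) ()
    statusOf-matched (no _)  _ (no _)  ()

    statusOf-out : ∀ {A B : Set} (a? : Dec A) m (b? : Dec B) → statusOf a? m b? ≡ out → ¬ A × ¬ B
    statusOf-out (yes _) (v _) _       ()
    statusOf-out (yes _) (w _) _       ()
    statusOf-out (yes _) (x _) _       ()
    statusOf-out (yes _) (y _) _       ()
    statusOf-out (yes _) (z _) _       ()
    statusOf-out (no _)  _     (yes _) ()
    statusOf-out (no ¬a) _     (no ¬b) _ = ¬a , ¬b

    status : Fin n → Status
    status i = statusOf (v i ∈? D') (mate (v i)) (w i ∈? D')

    status-in : ∀ i → v i ∈ D' → status i ≢ out
    status-in i vi∈ i-out = proj₁ (statusOf-out (v i ∈? D') (mate (v i)) (w i ∈? D') i-out) vi∈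

    status-matched : ∀ i j → v i ∈ D' → mate (v i) ≡ v j → status i ≡ matched
    status-matched i j vi∈ mate≡ with v i ∈? D' | mate (v i) | mate≡
    ... | yes _  | .(v j) | refl = refl
    ... | no vi∉ | _      | _    = ⊥-elim (vi∉ vi∈)

    partner : Fin n → Fin n
    partner i with mate (v i)
    ... | v j = j
    ... | _   = i

    partner-v : ∀ i j → mate (v i) ≡ v j → partner i ≡ j
    partner-v i j mate≡ with mate (v i) | mate≡
    ... | .(v j) | refl = refl

    partner-ok : ∀ i → status i ≡ matched →
      status (partner i) ≡ matched × Adj H i (partner i) × partner (partner i) ≡ i
    partner-ok i i-mat with statusOf-matched (v i ∈? D') (mate (v i)) (w i ∈? D') i-mat
    ... | vi∈ , j , mate-i with mate-ok (v i) vi∈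
    ...   | m∈ , vi~m , _ rewrite partner-v i j mate-i =
      status-matched j i vj∈ mate-j , edge (subst (GAdj H (v i)) mate-i vi~m) , partner-v j i mate-j
      where
      vj∈ : v j ∈ D'
      vj∈ = subst (_∈ D') mate-i m∈
      mate-j : mate (v j) ≡ v i
      mate-j = mate-back vi∈ mate-i
      edge : GAdj H (v i) (v j) → Adj H i j
      edge (vv i~j) = i~j

    -- An out vertex i is dominated in D' by a neighbour v j, since w i ∉ D'.
    dominatorOf : ∀ {i} → v i ∈ D' ⊎ Σ (GV n) (λ d → d ∈ D' × GAdj H (v i) d) → Fin n
    dominatorOf (inj₂ (v j , _)) = j
    dominatorOf {i} _            = i

    dominatorOf-ok : ∀ {i} (r : v i ∈ D' ⊎ Σ (GV n) (λ d → d ∈ D' × GAdj H (v i) d)) →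
      v i ∉ D' → w i ∉ D' → status (dominatorOf r) ≢ out × Adj H i (dominatorOf r)
    dominatorOf-ok (inj₁ vi∈)                    vi∉ _   = ⊥-elim (vi∉ vi∈)
    dominatorOf-ok (inj₂ (v j , vj∈ , vv i~j))  _   _   = status-in j vj∈ , i~j
    dominatorOf-ok (inj₂ (w _ , wi∈ , vw))      _   wi∉ = ⊥-elim (wi∉ wi∈)

    projected : Labelling
    projected = record
      { status       = status
      ; partner      = partner
      ; dominator    = λ i → dominatorOf (dominates (v i))
      ; partner-ok   = partner-ok
      ; dominator-ok = λ i i-out →
          let vi∉ , wi∉ = statusOf-out (v i ∈? D') (mate (v i)) (w i ∈? D') i-out
          in dominatorOf-ok (dominates (v i)) vi∉ wi∉
      }

    -- y i always lies in D' (it is z i's only neighbour), and so does its mate,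
    -- which is x i or z i.
    y∈ : ∀ i → y i ∈ D'
    y∈ i with dominates (z i)
    ... | inj₂ (d , d∈ , zi~d) = subst (_∈ D') (adj-z zi~d) d∈
    ... | inj₁ zi∈ with mate-ok (z i) zi∈
    ...   | m∈ , zi~m , _ = subst (_∈ D') (adj-z zi~m) m∈

    y-mate : ∀ i → (mate (y i) ≡ x i × x i ∈ D') ⊎ (mate (y i) ≡ z i × z i ∈ D')
    y-mate i with mate-ok (y i) (y∈ i)
    ... | m∈ , yi~m , _ with adj-y yi~m
    ...   | inj₁ m≡x = inj₁ (m≡x , subst (_∈ D') m≡x m∈)
    ...   | inj₂ m≡z = inj₂ (m≡z , subst (_∈ D') m≡z m∈)

    share : ∀ i (ws : List (GV n)) → Unique ws → All (λ a → a ∈ D' × gadget a ≡ i) ws →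
      length ws ≤ length (fibre gadget i D')
    share i ws distinct inside = unique-⊆-length distinct λ a∈ws →
      let a∈ , a-in-i = All.lookup inside a∈ws in ∈-filter⁺ (λ a → gadget a ≟ i) a∈ a-in-i

    -- Gadget i contains at least 2 + weight (status i) vertices of D': y i and
    -- its mate (x i or z i); also v i if i is matched; and two more if i is
    -- unmatched: v i and w i, or, when v i ∉ D', w i and its mate x i (then
    -- y i must be mated to z i).
    gadget-share : ∀ i (vi? : Dec (v i ∈ D')) (wi? : Dec (w i ∈ D')) →
      2 + weight (statusOf vi? (mate (v i)) wi?) ≤ length (fibre gadget i D')
    gadget-share i (no _) (no _) with y-mate i
    ... | inj₁ (_ , xi∈) = share i (y i ∷ x i ∷ []) (((λ ()) ∷ []) ∷ [] ∷ []) ((y∈ i , refl) ∷ (xi∈ , refl) ∷ [])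
    ... | inj₂ (_ , zi∈) = share i (y i ∷ z i ∷ []) (((λ ()) ∷ []) ∷ [] ∷ []) ((y∈ i , refl) ∷ (zi∈ , refl) ∷ [])
    gadget-share i (no vi∉) (yes wi∈) with mate-ok (w i) wi∈
    ... | m∈ , wi~m , _ with adj-w wi~m
    ...   | inj₁ m≡v = ⊥-elim (vi∉ (subst (_∈ D') m≡v m∈))
    ...   | inj₂ m≡x with y-mate i
    ...     | inj₁ (my≡x , _) = contradiction (trans (sym (mate-back (y∈ i) my≡x)) (mate-back wi∈ m≡x)) λ ()
    ...     | inj₂ (_ , zi∈) =
      share i (w i ∷ x i ∷ y i ∷ z i ∷ [])
        (((λ ()) ∷ (λ ()) ∷ (λ ()) ∷ []) ∷ ((λ ()) ∷ (λ ()) ∷ []) ∷ ((λ ()) ∷ []) ∷ [] ∷ [])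
        ((wi∈ , refl) ∷ (subst (_∈ D') m≡x m∈ , refl) ∷ (y∈ i , refl) ∷ (zi∈ , refl) ∷ [])
    gadget-share i (yes vi∈) wi? with mate (v i) | mate-ok (v i) vi∈
    ... | m | m∈ , vi~m , _ with adj-v vi~m | y-mate i
    ...   | inj₁ (j , refl , _) | inj₁ (_ , xi∈) =
      share i (v i ∷ y i ∷ x i ∷ []) (((λ ()) ∷ (λ ()) ∷ []) ∷ ((λ ()) ∷ []) ∷ [] ∷ [])
        ((vi∈ , refl) ∷ (y∈ i , refl) ∷ (xi∈ , refl) ∷ [])
    ...   | inj₁ (j , refl , _) | inj₂ (_ , zi∈) =
      share i (v i ∷ y i ∷ z i ∷ []) (((λ ()) ∷ (λ ()) ∷ []) ∷ ((λ ()) ∷ []) ∷ [] ∷ [])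
        ((vi∈ , refl) ∷ (y∈ i , refl) ∷ (zi∈ , refl) ∷ [])
    ...   | inj₂ refl | inj₁ (_ , xi∈) =
      share i (v i ∷ w i ∷ y i ∷ x i ∷ [])
        (((λ ()) ∷ (λ ()) ∷ (λ ()) ∷ []) ∷ ((λ ()) ∷ (λ ()) ∷ []) ∷ ((λ ()) ∷ []) ∷ [] ∷ [])
        ((vi∈ , refl) ∷ (m∈ , refl) ∷ (y∈ i , refl) ∷ (xi∈ , refl) ∷ [])
    ...   | inj₂ refl | inj₂ (_ , zi∈) =
      share i (v i ∷ w i ∷ y i ∷ z i ∷ [])
        (((λ ()) ∷ (λ ()) ∷ (λ ()) ∷ []) ∷ ((λ ()) ∷ (λ ()) ∷ []) ∷ ((λ ()) ∷ []) ∷ [] ∷ [])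
        ((vi∈ , refl) ∷ (m∈ , refl) ∷ (y∈ i , refl) ∷ (zi∈ , refl) ∷ [])

    projected-weight : 2 *ℕ n + weightOf projected ≤ length D'
    projected-weight =
      ≤-trans (≤-reflexive (sym (∑-2+ (weight ∘ status))))
     (≤-trans (∑-mono-≤ λ i → gadget-share i (v i ∈? D') (w i ∈? D'))
              (≤-reflexive (∑-length-fibre gadget D')))

  liftPairedDom : ∀ {n} (H : Graph (Fin n)) (D : List (Fin n)) → IsPairedDom H D →
    Σ (List (GV n)) (λ D' → IsPairedDom (GP4 H) D' × length D' ≡ 2 *ℕ n + length D)
  liftPairedDom H D D-pd = Lift.lifted H D D-pd , Lift.lifted-pd H D D-pd , Lift.length-lifted H D D-pd

  projectPairedDom : ∀ {n} (H : Graph (Fin n)) → (∀ u → Σ (Fin n) (Adj H u)) →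
    (D' : List (GV n)) → IsPairedDom (GP4 H) D' →
    Σ (List (Fin n)) (λ D → IsPairedDom H D × 2 *ℕ n + length D ≤ length D')
  projectPairedDom {n} H neighbour D' D'-pd
    with Repair.pairedDominatingOfLabelling H neighbour (Project.projected H D' D'-pd)
  ... | D , D-pd , small = D , D-pd , ≤-trans (+-monoʳ-≤ (2 *ℕ n) small) (Project.projected-weight H D' D'-pd)


open import Defs using (Graph; Connected; IsPairedDom; GV; GP4)
open import Data.Nat using (ℕ; suc; _≥_; s≤s) renaming (_*_ to _*ℕ_)
open import Data.Fin using (Fin)
open import Data.Integer using (ℤ; +_; _+_; _≤_; -_; +≤+)
open import Data.Integer.Properties using (+-monoʳ-≤; +-assoc; +-inverseˡ; +-identityˡ; pos-+; ≤-trans)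
open import Data.List using (List; length)
open import Data.Product using (Σ; _×_; _,_)
open import Function.Bundles using (_⇔_; mk⇔)
open import Relation.Binary.PropositionalEquality using (_≡_; sym; trans; cong; subst; subst₂; module ≡-Reasoning)
open PairedDomination using (connected⇒neighbour; liftPairedDom; projectPairedDom)

+-cancelˡ-≤ : ∀ a {b c : ℤ} → a + b ≤ a + c → b ≤ c
+-cancelˡ-≤ a {b} {c} a+b≤a+c = subst₂ _≤_ (-a+[a+t]≡t b) (-a+[a+t]≡t c) (+-monoʳ-≤ (- a) a+b≤a+c)
  where
  open ≡-Reasoning
  -a+[a+t]≡t : ∀ t → - a + (a + t) ≡ t
  -a+[a+t]≡t t = begin
    - a + (a + t) ≡⟨ sym (+-assoc (- a) a t) ⟩
    - a + a + t   ≡⟨ cong (_+ t) (+-inverseˡ a) ⟩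
    + 0 + t       ≡⟨ +-identityˡ t ⟩
    t             ∎

lemma1 : (n : ℕ) → (H : Graph (Fin n)) → Connected H → n ≥ 2 →
    (k : ℤ) → k ≤ + n →
    (Σ (List (Fin n)) (λ D → IsPairedDom H D × + length D ≤ k))
    ⇔ (Σ (List (GV n)) (λ D → IsPairedDom (GP4 H) D × + length D ≤ (+ (2 *ℕ n)) + k))
lemma1 n@(suc (suc _)) H connected (s≤s (s≤s _)) k _ = mk⇔ lift project
  where
  lift : Σ (List (Fin n)) (λ D → IsPairedDom H D × + length D ≤ k) →
         Σ (List (GV n)) (λ D → IsPairedDom (GP4 H) D × + length D ≤ (+ (2 *ℕ n)) + k)
  lift (D , D-pd , |D|≤k) with liftPairedDom H D D-pd
  ... | D' , D'-pd , |D'|≡ = D' , D'-pd ,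
    subst (_≤ + (2 *ℕ n) + k) (sym (trans (cong +_ |D'|≡) (pos-+ (2 *ℕ n) (length D))))
          (+-monoʳ-≤ (+ (2 *ℕ n)) |D|≤k)
  project : Σ (List (GV n)) (λ D → IsPairedDom (GP4 H) D × + length D ≤ (+ (2 *ℕ n)) + k) →
            Σ (List (Fin n)) (λ D → IsPairedDom H D × + length D ≤ k)
  project (D' , D'-pd , |D'|≤) with projectPairedDom H (connected⇒neighbour H connected) D' D'-pd
  ... | D , D-pd , 2n+|D|≤|D'| = D , D-pd ,
    +-cancelˡ-≤ (+ (2 *ℕ n))
      (≤-trans (subst (_≤ + length D') (pos-+ (2 *ℕ n) (length D)) (+≤+ 2n+|D|≤|D'|)) |D'|≤)
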